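{- Let $T=(K,L,R)$ and let $(b_T(n))_{n\in\mathbb N_0}$ be any sequence associated with $T$. Let $h\in\mathbb N$ be coprime to $r=\sum_{j=0}^{u}r_j$ and satisfy $2\le h\le \underline{\deg}\,K-u+1$. Then at least one of the following holds: (1) all but finitely many values $b_T(n)$ are divisible by $h$; (2) all but finitely many values $b_T(n)$ are not coprime to $h$, and (1) does not hold; (3) for every integer sequence $(d_T(n))_{n\in\mathbb N_0}$ such that $$d_T(k_n+s)-d_T(k_n+s-1)=l_0b_T(k_{k_n+s})+l_1b_T(k_{k_n+s-1})+\dots+l_tb_T(k_{k_n+s-t})$$ for all $n\in\mathbb N_0$ and $s\in\{0,\dots,k_{n+1}-k_n-1\}$ with $k_n+s\ge1$, every residue class modulo $h$ appears infinitely many times in $(d_T(n)\bmod h)_{n\in\mathbb N_0}$. Moreover, the only two of these conditions that can hold simultaneously are (2) and (3).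
   Context: Let $K=(k_n)_{n\in\mathbb N_0}$ be a strictly increasing sequence of non-negative integers with $k_0=0$; set $k_{ -n}=-n$ for $n\in\mathbb N$. Let $L=(l_0,\dots,l_t)$ and $R=(r_0,\dots,r_u)$ be finite sequences of integers and $T=(K,L,R)$. A sequence of integers $(b_T(n))_{n\in\mathbb N_0}$, extended by $b_T(q)=0$ for negative integers $q$, is associated with $T$ if for every $n\in\mathbb N_0$: (a) $b_T(k_n)=b_T(k_n+1)=\dots=b_T(k_{n+1}-1)$, and (b) $\sum_{i=0}^{t}l_ib_T(k_{n-i})=\sum_{j=0}^{u}r_jb_T(n-j)$ (initial values are otherwise arbitrary). The lower degree of $K$ is $\underline{\deg}\,K=\inf\{d\in\mathbb N:\ k_n-k_{n-1}=d \text{ for infinitely many } n\}$. -}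

module Defs where

open import Data.Nat as ℕ using (ℕ; zero; suc; _≤_; _<_)
open import Data.Nat.Coprimality using (Coprime)
open import Data.Integer as ℤ using (ℤ; +_; -[1+_]; _+_; _-_; _*_; ∣_∣)
open import Data.Integer.Divisibility using (_∣_)
open import Data.Fin using (Fin; toℕ)
open import Data.Vec using (Vec; lookup)
open import Data.Product using (Σ; ∃; _×_)
open import Relation.Binary.PropositionalEquality using (_≡_)
open import Relation.Nullary using (¬_)

sumFin : (n : ℕ) → (Fin n → ℤ) → ℤ
sumFin zero    f = + 0
sumFin (suc n) f = f Fin.zero + sumFin n (λ i → f (Fin.suc i))

InfinitelyOften : (ℕ → Set) → Set
InfinitelyOften P = (N : ℕ) → ∃ λ n → N ≤ n × P n

Eventually : (ℕ → Set) → Set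
Eventually P = ∃ λ N → (n : ℕ) → N ≤ n → P n

IsK : (ℕ → ℕ) → Set
IsK k = (k 0 ≡ 0) × ((n : ℕ) → k n < k (suc n))

kExt : (ℕ → ℕ) → ℤ → ℤ
kExt k (+ n)      = + k n
kExt k -[1+ m ]   = -[1+ m ]

bExt : (ℕ → ℤ) → ℤ → ℤ
bExt b (+ n)     = b n
bExt b -[1+ m ]  = + 0

lhsSum : (k : ℕ → ℕ) (t : ℕ) (l : Vec ℤ (suc t)) (b : ℕ → ℤ) → ℤ → ℤ
lhsSum k t l b m = sumFin (suc t) (λ i → lookup l i * bExt b (kExt k (m - + toℕ i)))

rhsSum : (u : ℕ) (r : Vec ℤ (suc u)) (b : ℕ → ℤ) → ℤ → ℤ
rhsSum u r b m = sumFin (suc u) (λ j → lookup r j * bExt b (m - + toℕ j))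

Associated : (k : ℕ → ℕ) (t u : ℕ) (l : Vec ℤ (suc t)) (r : Vec ℤ (suc u)) (b : ℕ → ℤ) → Set
Associated k t u l r b =
  ((n m : ℕ) → k n ≤ m → m < k (suc n) → b m ≡ b (k n))
  × ((n : ℕ) → lhsSum k t l b (+ n) ≡ rhsSum u r b (+ n))

InDiffSet : (ℕ → ℕ) → ℕ → Set
InDiffSet k d = (1 ≤ d) × InfinitelyOften (λ n → kExt k (+ n) - kExt k (+ n - + 1) ≡ + d)

-- m ≤ lower degree of K  (inf over ℕ, inf ∅ = ∞), i.e. m is a lower bound of the set
LowerDegreeAtLeast : (ℕ → ℕ) → ℕ → Set
LowerDegreeAtLeast k m = (d : ℕ) → InDiffSet k d → m ≤ d

Cond1 : ℕ → (ℕ → ℤ) → Set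
Cond1 h b = Eventually (λ n → (+ h) ∣ b n)

Cond2 : ℕ → (ℕ → ℤ) → Set
Cond2 h b = Eventually (λ n → ¬ Coprime h ∣ b n ∣) × ¬ Cond1 h b

IsDSeq : (k : ℕ → ℕ) (t : ℕ) (l : Vec ℤ (suc t)) (b : ℕ → ℤ) (d : ℕ → ℤ) → Set
IsDSeq k t l b d = (n s : ℕ) → s < k (suc n) ℕ.∸ k n → 1 ≤ k n ℕ.+ s →
  d (k n ℕ.+ s) - d (k n ℕ.+ s ℕ.∸ 1) ≡ lhsSum k t l b (+ (k n ℕ.+ s))

Cond3 : (k : ℕ → ℕ) (t : ℕ) (l : Vec ℤ (suc t)) (b : ℕ → ℤ) (h : ℕ) → Set
Cond3 k t l b h = (d : ℕ → ℤ) → IsDSeq k t l b d →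
  (c : ℤ) → InfinitelyOften (λ n → (+ h) ∣ (d n - c))

-- On a block [k n, k (n+1)) the sequence b is constant, so once s ≥ u every term of
-- Σ r_j b(k n + s - j) equals b(k n), and the recurrence says that d increases by the
-- constant step R b(k n) across the block, where R = Σ r_j.  If infinitely many b(k n)
-- are coprime to h and the blocks are eventually longer than h + u - 2, then h
-- consecutive values of d form an arithmetic progression whose step is invertible
-- modulo h, so they meet every residue class: this is (3).  Conversely, if (1) holds,
-- every increment of d is eventually divisible by h, so d is eventually constant modulo
-- h and (3) fails for the partial sums of the left-hand side.
module Submission where

open import Defs
open import Level using (0ℓ)
open import Axiom.ExcludedMiddle using (ExcludedMiddle)
open import Data.Nat as ℕ using (ℕ; zero; suc; _≤_; _<_; _+_; _∸_; _≤′_; ≤′-refl; ≤′-step; z≤n; s≤s; NonZero)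
open import Data.Nat.Properties
import Data.Nat.Divisibility as ℕ
open import Data.Nat.Coprimality as Coprime using (Coprime)
open import Data.Nat.GCD using (module Bézout)
open import Data.Integer as ℤ using (ℤ; ∣_∣; +_; -_; 0ℤ; 1ℤ; _%ℕ_; _/ℕ_)
open import Data.Integer.Properties as ℤ
  using (pos-*; m-n≡m⊖n; ⊖-≥; abs-*; neg-distribˡ-*; neg-distribʳ-*; +∣i∣≡i⊎+∣i∣≡-i)
open import Data.Integer.DivMod using (a≡a%ℕn+[a/ℕn]*n; n%ℕd<d)
open import Data.Integer.Divisibility.Signed
  using (_∣_; divides; ∣ᵤ⇒∣; ∣⇒∣ᵤ; ∣m∣n⇒∣m+n; ∣m∣n⇒∣m-n; ∣n⇒∣m*n; ∣m⇒∣m*n)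
open import Data.Integer.Tactic.RingSolver using (solve-∀)
open import Data.Fin using (Fin; toℕ)
open import Data.Fin.Properties using (toℕ≤pred[n])
open import Data.Vec using (Vec; lookup)
open import Data.Product using (∃; ∃-syntax; _×_; _,_; proj₁; proj₂)
open import Data.Sum using (_⊎_; inj₁; inj₂)
open import Function using (_∘_)
open import Relation.Nullary using (¬_; yes; no; contradiction)
open import Relation.Binary.PropositionalEquality

pos-∸ : ∀ {m j} → j ≤ m → + m ℤ.- + j ≡ + (m ∸ j)
pos-∸ {m} {j} j≤m = trans (m-n≡m⊖n m j) (⊖-≥ j≤m)

suc≤⇒≡suc : ∀ {N m} → suc N ≤ m → ∃[ p ] m ≡ suc p × N ≤ p
suc≤⇒≡suc (s≤s N≤p) = _ , refl , N≤p

sumFin-cong : ∀ n {f g : Fin n → ℤ} → (∀ i → f i ≡ g i) → sumFin n f ≡ sumFin n g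
sumFin-cong zero    f≗g = refl
sumFin-cong (suc n) f≗g = cong₂ ℤ._+_ (f≗g Fin.zero) (sumFin-cong n (f≗g ∘ Fin.suc))

sumFin-*ʳ : ∀ n (f : Fin n → ℤ) c → sumFin n (λ i → f i ℤ.* c) ≡ sumFin n f ℤ.* c
sumFin-*ʳ zero    f c = refl
sumFin-*ʳ (suc n) f c = trans (cong (ℤ._+_ (f Fin.zero ℤ.* c)) (sumFin-*ʳ n (f ∘ Fin.suc) c))
                              (sym (ℤ.*-distribʳ-+ c (f Fin.zero) _))

∣-sumFin : ∀ {q} n {f : Fin n → ℤ} → (∀ i → q ∣ f i) → q ∣ sumFin n f
∣-sumFin zero    q∣f = divides 0ℤ refl
∣-sumFin (suc n) q∣f = ∣m∣n⇒∣m+n (q∣f Fin.zero) (∣-sumFin n (q∣f ∘ Fin.suc))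

coprime-* : ∀ {h a c} → Coprime h a → Coprime h c → Coprime h (a ℕ.* c)
coprime-* {a = a} ha hc {d} (d∣h , d∣ac) = hc (d∣h , Coprime.coprime-divisor d⊥a d∣ac)
  where d⊥a : Coprime d a
        d⊥a (e∣d , e∣a) = ha (ℕ.∣-trans e∣d d∣h , e∣a)

coprime-∣*∣ : ∀ {h} x y → Coprime h ∣ x ∣ → Coprime h ∣ y ∣ → Coprime h ∣ x ℤ.* y ∣
coprime-∣*∣ {h} x y hx hy = subst (Coprime h) (sym (abs-* x y)) (coprime-* hx hy)

pos-Bézout : ∀ p q r s → 1 + p ℕ.* q ≡ r ℕ.* s → 1ℤ ℤ.+ + p ℤ.* + q ≡ + r ℤ.* + s
pos-Bézout p q r s eq =
  trans (cong (ℤ._+_ 1ℤ) (sym (pos-* p q))) (trans (cong +_ eq) (pos-* r s))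

inverse-mod-ℕ : ∀ {h a} → Coprime h a → ∃[ z ] + h ∣ z ℤ.* + a ℤ.- 1ℤ
inverse-mod-ℕ {h} {a} cop with Coprime.coprime-Bézout cop
... | Bézout.+- x y eq = - + y , divides (- + x) (begin
  - + y ℤ.* + a ℤ.- 1ℤ     ≡⟨ lemma (+ y) (+ a) ⟩
  - (1ℤ ℤ.+ + y ℤ.* + a)   ≡⟨ cong -_ (pos-Bézout y a x h eq) ⟩
  - (+ x ℤ.* + h)          ≡⟨ neg-distribˡ-* (+ x) (+ h) ⟩
  - + x ℤ.* + h            ∎)
  where open ≡-Reasoning
        lemma : ∀ Y A → - Y ℤ.* A ℤ.- 1ℤ ≡ - (1ℤ ℤ.+ Y ℤ.* A)
        lemma = solve-∀
... | Bézout.-+ x y eq = + y , divides (+ x) (begin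
  + y ℤ.* + a ℤ.- 1ℤ                ≡⟨ cong (ℤ._- 1ℤ) (pos-Bézout x h y a eq) ⟨
  1ℤ ℤ.+ + x ℤ.* + h ℤ.- 1ℤ         ≡⟨ lemma (+ x ℤ.* + h) ⟩
  + x ℤ.* + h                       ∎)
  where open ≡-Reasoning
        lemma : ∀ X → 1ℤ ℤ.+ X ℤ.- 1ℤ ≡ X
        lemma = solve-∀

inverse-mod : ∀ {h} w → Coprime h ∣ w ∣ → ∃[ z ] + h ∣ z ℤ.* w ℤ.- 1ℤ
inverse-mod {h} w cop with inverse-mod-ℕ cop | +∣i∣≡i⊎+∣i∣≡-i w
... | z , h∣za-1 | inj₁ ∣w∣≡w  = z , subst (λ v → + h ∣ z ℤ.* v ℤ.- 1ℤ) ∣w∣≡w h∣za-1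
... | z , h∣za-1 | inj₂ ∣w∣≡-w = - z , subst (λ v → + h ∣ v ℤ.- 1ℤ) z∣w∣≡-z*w h∣za-1
  where z∣w∣≡-z*w : z ℤ.* + ∣ w ∣ ≡ - z ℤ.* w
        z∣w∣≡-z*w = trans (cong (ℤ._*_ z) ∣w∣≡-w) (trans (sym (neg-distribʳ-* z w)) (neg-distribˡ-* z w))

hits-every-residue : ∀ h .{{_ : NonZero h}} w → Coprime h ∣ w ∣ →
                     ∀ x c → ∃[ i ] i < h × + h ∣ x ℤ.+ + i ℤ.* w ℤ.- c
hits-every-residue h w cop x c with inverse-mod w cop
... | w⁻¹ , h∣w⁻¹w-1 = i , n%ℕd<d (w⁻¹ ℤ.* e) h , subst (+ h ∣_) (sym (identity x c w⁻¹ w (+ i))) h∣rhs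
  where
  e = c ℤ.- x
  i = (w⁻¹ ℤ.* e) %ℕ h
  h∣w⁻¹e-i : + h ∣ w⁻¹ ℤ.* e ℤ.- + i
  h∣w⁻¹e-i = divides ((w⁻¹ ℤ.* e) /ℕ h)
    (trans (cong (ℤ._- + i) (a≡a%ℕn+[a/ℕn]*n (w⁻¹ ℤ.* e) h)) (cancel (+ i) _))
    where cancel : ∀ I Q → I ℤ.+ Q ℤ.- I ≡ Q
          cancel = solve-∀
  h∣rhs : + h ∣ e ℤ.* (w⁻¹ ℤ.* w ℤ.- 1ℤ) ℤ.- (w⁻¹ ℤ.* e ℤ.- + i) ℤ.* w
  h∣rhs = ∣m∣n⇒∣m-n (∣n⇒∣m*n e h∣w⁻¹w-1) (∣m⇒∣m*n w h∣w⁻¹e-i)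
  identity : ∀ x c z w I → x ℤ.+ I ℤ.* w ℤ.- c
           ≡ (c ℤ.- x) ℤ.* (z ℤ.* w ℤ.- 1ℤ) ℤ.- (z ℤ.* (c ℤ.- x) ℤ.- I) ℤ.* w
  identity = solve-∀

module _ (em : ExcludedMiddle 0ℓ) {P : ℕ → Set} where

  ¬Eventually¬⇒InfinitelyOften : ¬ Eventually (¬_ ∘ P) → InfinitelyOften P
  ¬Eventually¬⇒InfinitelyOften ¬ev N with em {∃ λ n → N ≤ n × P n}
  ... | yes witness = witness
  ... | no ¬witness = contradiction (N , λ n N≤n Pn → ¬witness (n , N≤n , Pn)) ¬ev

  ¬InfinitelyOften⇒Eventually¬ : ¬ InfinitelyOften P → Eventually (¬_ ∘ P)
  ¬InfinitelyOften⇒Eventually¬ ¬io with em {Eventually (¬_ ∘ P)}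
  ... | yes ev  = ev
  ... | no ¬ev = contradiction (¬Eventually¬⇒InfinitelyOften ¬ev) ¬io

Eventually-× : ∀ {P Q : ℕ → Set} → Eventually P → Eventually Q → Eventually (λ n → P n × Q n)
Eventually-× (M , P≥M) (N , Q≥N) =
  M + N , λ n M+N≤n → P≥M n (≤-trans (m≤m+n M N) M+N≤n) , Q≥N n (≤-trans (m≤n+m N M) M+N≤n)

InfinitelyOften-× : ∀ {P Q : ℕ → Set} → InfinitelyOften P → Eventually Q →
                    InfinitelyOften (λ n → P n × Q n)
InfinitelyOften-× io (M , Q≥M) N with io (M + N)
... | n , M+N≤n , Pn = n , ≤-trans (m≤n+m N M) M+N≤n , Pn , Q≥M n (≤-trans (m≤m+n M N) M+N≤n)

arithmetic-progression : ∀ (f : ℕ → ℤ) a δ {L} →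
  (∀ i → i < L → f (suc (a + i)) ℤ.- f (a + i) ≡ δ) →
  ∀ i → i ≤ L → f (a + i) ≡ f a ℤ.+ + i ℤ.* δ
arithmetic-progression f a δ step zero    _   = trans (cong f (+-identityʳ a)) (sym (ℤ.+-identityʳ (f a)))
arithmetic-progression f a δ step (suc i) i<L = begin
  f (a + suc i)                       ≡⟨ cong f (+-suc a i) ⟩
  f (suc (a + i))                     ≡⟨ shift (step i i<L) ⟩
  f (a + i) ℤ.+ δ                     ≡⟨ cong (λ v → v ℤ.+ δ) previous ⟩
  f a ℤ.+ + i ℤ.* δ ℤ.+ δ             ≡⟨ collect (f a) (+ i) δ ⟩
  f a ℤ.+ + suc i ℤ.* δ               ∎
  where
  open ≡-Reasoning
  previous = arithmetic-progression f a δ step i (<⇒≤ i<L)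
  shift : ∀ {x y} → x ℤ.- y ≡ δ → x ≡ y ℤ.+ δ
  shift {x} {y} refl = sym (cancel x y)
    where cancel : ∀ x y → y ℤ.+ (x ℤ.- y) ≡ x
          cancel = solve-∀
  collect : ∀ x I d → x ℤ.+ I ℤ.* d ℤ.+ d ≡ x ℤ.+ (1ℤ ℤ.+ I) ℤ.* d
  collect = solve-∀

∣-increments⇒∣-differences : ∀ {q} (f : ℕ → ℤ) {M} → (∀ m → M ≤ m → q ∣ f (suc m) ℤ.- f m) →
                             ∀ {n} → M ≤′ n → q ∣ f n ℤ.- f M
∣-increments⇒∣-differences f {M} q∣Δf ≤′-refl = divides 0ℤ (ℤ.+-inverseʳ (f M))
∣-increments⇒∣-differences f {M} q∣Δf (≤′-step {n} M≤′n) =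
  subst (_ ∣_) (telescope (f (suc n)) (f n) (f M))
    (∣m∣n⇒∣m+n (q∣Δf n (≤′⇒≤ M≤′n)) (∣-increments⇒∣-differences f q∣Δf M≤′n))
  where telescope : ∀ x y z → (x ℤ.- y) ℤ.+ (y ℤ.- z) ≡ x ℤ.- z
        telescope = solve-∀

module Blocks {k : ℕ → ℕ} (isK : IsK k) where

  k-increasing : ∀ n → k n < k (suc n)
  k-increasing = proj₂ isK

  gap : ℕ → ℕ
  gap n = k (suc n) ∸ k n

  k-monotone : ∀ {m n} → m ≤ n → k m ≤ k n
  k-monotone {n = zero} z≤n = ≤-refl
  k-monotone {m} {suc n} m≤1+n with m≤n⇒m<n∨m≡n m≤1+n
  ... | inj₁ m<1+n = ≤-trans (k-monotone (ℕ.s≤s⁻¹ m<1+n)) (<⇒≤ (k-increasing n))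
  ... | inj₂ refl  = ≤-refl

  k-cancel-< : ∀ {m n} → k m < k n → m < n
  k-cancel-< {m} {n} km<kn with m <? n
  ... | yes m<n = m<n
  ... | no  m≮n = contradiction (k-monotone (≮⇒≥ m≮n)) (<⇒≱ km<kn)

  n≤k[n] : ∀ n → n ≤ k n
  n≤k[n] zero    = z≤n
  n≤k[n] (suc n) = ≤-trans (s≤s (n≤k[n] n)) (k-increasing n)

  block-of : ∀ m → ∃[ n ] k n ≤ m × m < k (suc n)
  block-of zero = 0 , ≤-reflexive (proj₁ isK) , subst (_< k 1) (proj₁ isK) (k-increasing 0)
  block-of (suc m) with block-of m
  ... | n , kn≤m , m<kn+1 with suc m <? k (suc n)
  ...   | yes m+1<kn+1 = n , ≤-trans kn≤m (n≤1+n m) , m+1<kn+1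
  ...   | no  m+1≮kn+1 = suc n , ≤-reflexive (sym m+1≡kn+1) ,
                         subst (_< k (2 + n)) (sym m+1≡kn+1) (k-increasing (suc n))
    where m+1≡kn+1 = ≤-antisym m<kn+1 (≮⇒≥ m+1≮kn+1)

  <gap⇒<k[1+n] : ∀ {n s} → s < gap n → k n + s < k (suc n)
  <gap⇒<k[1+n] {n} s<gap = subst (k n + _ <_) (m+[n∸m]≡n (<⇒≤ (k-increasing n))) (+-monoʳ-< (k n) s<gap)

  kExt-gap : ∀ n → kExt k (+ suc n) ℤ.- kExt k (+ suc n ℤ.- 1ℤ) ≡ + gap n
  kExt-gap n = trans (cong (λ v → + k (suc n) ℤ.- kExt k v) (pos-∸ {suc n} {1} (s≤s z≤n)))
                     (pos-∸ (<⇒≤ (k-increasing n)))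

  rare-gap : ∀ {d} → LowerDegreeAtLeast k (suc d) → ¬ InfinitelyOften (λ n → gap n ≡ d)
  rare-gap {zero} _ io with io 0
  ... | n , _ , gap≡0 = <⇒≢ (m<n⇒0<n∸m (k-increasing n)) (sym gap≡0)
  rare-gap {suc d} low io = 1+n≰n (low (suc d) (s≤s z≤n , io′))
    where io′ : InfinitelyOften (λ n → kExt k (+ n) ℤ.- kExt k (+ n ℤ.- 1ℤ) ≡ + suc d)
          io′ N with io N
          ... | n , N≤n , gap≡1+d = suc n , ≤-trans N≤n (n≤1+n n) , trans (kExt-gap n) (cong +_ gap≡1+d)

  eventually-gap≥ : ExcludedMiddle 0ℓ → ∀ {B} → LowerDegreeAtLeast k B → Eventually (λ n → B ≤ gap n)
  eventually-gap≥ em {zero}  _   = 0 , λ _ _ → z≤n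
  eventually-gap≥ em {suc B} low
    with Eventually-× (eventually-gap≥ em (λ d d∈ → ≤-trans (n≤1+n B) (low d d∈)))
                      (¬InfinitelyOften⇒Eventually¬ em (rare-gap low))
  ... | N , ev = N , λ n N≤n → let B≤gap , gap≢B = ev n N≤n in ≤∧≢⇒< B≤gap (gap≢B ∘ sym)

bExt-shift : ∀ {b m j} → j ≤ m → bExt b (+ m ℤ.- + j) ≡ b (m ∸ j)
bExt-shift {b} j≤m = cong (bExt b) (pos-∸ j≤m)

∣-rhsSum : ∀ {q N} u r b → (∀ m → N ≤ m → q ∣ b m) → ∀ m → N + u ≤ m → q ∣ rhsSum u r b (+ m)
∣-rhsSum {q} {N} u r b q∣b m N+u≤m = ∣-sumFin (suc u) q∣term
  where
  q∣term : ∀ j → q ∣ lookup r j ℤ.* bExt b (+ m ℤ.- + toℕ j)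
  q∣term j = ∣n⇒∣m*n (lookup r j) (subst (q ∣_) (sym (bExt-shift j≤m)) (q∣b (m ∸ toℕ j) N≤m∸j))
    where
    j≤u = toℕ≤pred[n] j
    j≤m = ≤-trans j≤u (≤-trans (m≤n+m u N) N+u≤m)
    N≤m∸j = ≤-trans (≤-reflexive (sym (m+n∸n≡m N u))) (∸-mono N+u≤m j≤u)

module AssociatedSequence {k : ℕ → ℕ} (isK : IsK k) (t u : ℕ) (l : Vec ℤ (suc t)) (r : Vec ℤ (suc u))
                          (b : ℕ → ℤ) (assoc : Associated k t u l r b) where
  open Blocks isK

  R : ℤ
  R = sumFin (suc u) (lookup r)

  constant-on-blocks : ∀ n m → k n ≤ m → m < k (suc n) → b m ≡ b (k n)
  constant-on-blocks = proj₁ assoc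

  recurrence : ∀ n → lhsSum k t l b (+ n) ≡ rhsSum u r b (+ n)
  recurrence = proj₂ assoc

  InfinitelyOften-block-starts : ∀ (P : ℤ → Set) → InfinitelyOften (P ∘ b) → InfinitelyOften (P ∘ b ∘ k)
  InfinitelyOften-block-starts P io N with io (k N)
  ... | m , kN≤m , Pbm with block-of m
  ...   | n , kn≤m , m<kn+1 = n , ℕ.s≤s⁻¹ (k-cancel-< (≤-<-trans kN≤m m<kn+1)) ,
                              subst P (constant-on-blocks n m kn≤m m<kn+1) Pbm

  rhsSum-on-block : ∀ {n s} → u ≤ s → s < gap n → rhsSum u r b (+ (k n + s)) ≡ R ℤ.* b (k n)
  rhsSum-on-block {n} {s} u≤s s<gap =
    trans (sumFin-cong (suc u) term) (sumFin-*ʳ (suc u) (lookup r) (b (k n)))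
    where
    term : ∀ j → lookup r j ℤ.* bExt b (+ (k n + s) ℤ.- + toℕ j) ≡ lookup r j ℤ.* b (k n)
    term j = cong (ℤ._*_ (lookup r j)) (trans (bExt-shift j≤kn+s) (constant-on-blocks n _ kn≤ <kn+1))
      where
      j≤s = ≤-trans (toℕ≤pred[n] j) u≤s
      j≤kn+s = ≤-trans j≤s (m≤n+m s (k n))
      kn≤ = subst (k n ≤_) (sym (+-∸-assoc (k n) j≤s)) (m≤m+n (k n) (s ∸ toℕ j))
      <kn+1 = ≤-<-trans (m∸n≤m (k n + s) (toℕ j)) (<gap⇒<k[1+n] s<gap)

  module _ (d : ℕ → ℤ) (isd : IsDSeq k t l b d) where

    d-step : ∀ {n p s} → k n ≡ suc p → u ≤ s → s < gap n → d (suc (p + s)) ℤ.- d (p + s) ≡ R ℤ.* b (k n)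
    d-step {n} {p} {s} kn≡1+p u≤s s<gap =
      subst (λ K → d (K + s) ℤ.- d (K + s ∸ 1) ≡ R ℤ.* b (k n)) kn≡1+p (begin
        d (k n + s) ℤ.- d (k n + s ∸ 1)   ≡⟨ isd n s s<gap (subst (λ K → 1 ≤ K + s) (sym kn≡1+p) (s≤s z≤n)) ⟩
        lhsSum k t l b (+ (k n + s))      ≡⟨ recurrence (k n + s) ⟩
        rhsSum u r b (+ (k n + s))        ≡⟨ rhsSum-on-block u≤s s<gap ⟩
        R ℤ.* b (k n)                     ∎)
      where open ≡-Reasoning

    hits-residue-in-block : ∀ {h} .{{_ : NonZero h}} → Coprime h ∣ R ∣ → ∀ {n p} → k n ≡ suc p →
                            Coprime h ∣ b (k n) ∣ → h + u ∸ 1 ≤ gap n →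
                            ∀ c → ∃[ i ] + h ∣ d (p + u + i) ℤ.- c
    hits-residue-in-block {h@(suc h-1)} R⊥h {n} {p} kn≡1+p bkn⊥h long c =
      let i , i<h , h∣ = hits-every-residue h δ (coprime-∣*∣ R (b (k n)) R⊥h bkn⊥h) (d (p + u)) c
      in i , subst (λ v → + h ∣ v ℤ.- c) (sym (progression i (ℕ.s≤s⁻¹ i<h))) h∣
      where
      δ = R ℤ.* b (k n)
      step : ∀ i → i < h-1 → d (suc (p + u + i)) ℤ.- d (p + u + i) ≡ δ
      step i i<h-1 = subst (λ v → d (suc v) ℤ.- d v ≡ δ) (sym (+-assoc p u i))
        (d-step kn≡1+p (m≤m+n u i) (<-≤-trans (subst (u + i <_) (+-comm u h-1) (+-monoʳ-< u i<h-1)) long))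
      progression = arithmetic-progression d (p + u) δ step

  long-coprime-blocks : ExcludedMiddle 0ℓ → ∀ {h} → LowerDegreeAtLeast k (h + u ∸ 1) →
                        ¬ Eventually (λ n → ¬ Coprime h ∣ b n ∣) →
                        InfinitelyOften (λ n → Coprime h ∣ b (k n) ∣ × h + u ∸ 1 ≤ gap n)
  long-coprime-blocks em {h} low ¬cond2 =
    InfinitelyOften-×
      (InfinitelyOften-block-starts (λ z → Coprime h ∣ z ∣) (¬Eventually¬⇒InfinitelyOften em ¬cond2))
      (eventually-gap≥ em low)

  ¬Eventually¬Coprime⇒Cond3 : ExcludedMiddle 0ℓ → ∀ {h} .{{_ : NonZero h}} → Coprime h ∣ R ∣ →
                              LowerDegreeAtLeast k (h + u ∸ 1) →
                              ¬ Eventually (λ n → ¬ Coprime h ∣ b n ∣) → Cond3 k t l b h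
  ¬Eventually¬Coprime⇒Cond3 em R⊥h low ¬cond2 d isd c N with long-coprime-blocks em low ¬cond2 (suc N)
  ... | n , 1+N≤n , bkn⊥h , long with suc≤⇒≡suc (≤-trans 1+N≤n (n≤k[n] n))
  ...   | p , kn≡1+p , N≤p =
    let i , h∣ = hits-residue-in-block d isd R⊥h kn≡1+p bkn⊥h long c
    in p + u + i , ≤-trans N≤p (≤-trans (m≤m+n p u) (m≤m+n (p + u) i)) , ∣⇒∣ᵤ h∣

partialSums : (ℕ → ℤ) → ℕ → ℤ
partialSums g zero    = 0ℤ
partialSums g (suc m) = partialSums g m ℤ.+ g (suc m)

partialSums-step : ∀ g m → partialSums g (suc m) ℤ.- partialSums g m ≡ g (suc m)
partialSums-step g m = cancel (partialSums g m) (g (suc m))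
  where cancel : ∀ x y → x ℤ.+ y ℤ.- x ≡ y
        cancel = solve-∀

partialSums-IsDSeq : ∀ k t l b → IsDSeq k t l b (partialSums (lhsSum k t l b ∘ +_))
partialSums-IsDSeq k t l b n s _ 1≤kn+s with k n + s | 1≤kn+s
... | suc m | _ = partialSums-step (lhsSum k t l b ∘ +_) m

Cond1⇒¬Cond3 : ∀ k t u l r b {h} → (∀ n → lhsSum k t l b (+ n) ≡ rhsSum u r b (+ n)) →
               2 ≤ h → Cond1 h b → ¬ Cond3 k t l b h
Cond1⇒¬Cond3 k t u l r b {h} recurrence 2≤h (N , h∣b) cond3 =
  let n , M≤n , h∣dn-dM-1 = cond3 d (partialSums-IsDSeq k t l b) (d M ℤ.+ 1ℤ) M
      h∣dn-dM             = ∣-increments⇒∣-differences d h∣Δd (≤⇒≤′ M≤n)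
      h∣1                 = subst (+ h ∣_) (cancel (d n) (d M)) (∣m∣n⇒∣m-n h∣dn-dM (∣ᵤ⇒∣ h∣dn-dM-1))
  in 1+n≰n (subst (2 ≤_) (ℕ.∣1⇒≡1 (∣⇒∣ᵤ h∣1)) 2≤h)
  where
  d = partialSums (lhsSum k t l b ∘ +_)
  M = N + u
  h∣Δd : ∀ m → M ≤ m → + h ∣ d (suc m) ℤ.- d m
  h∣Δd m M≤m = subst (+ h ∣_) (sym (trans (partialSums-step _ m) (recurrence (suc m))))
                 (∣-rhsSum u r b (λ n N≤n → ∣ᵤ⇒∣ (h∣b n N≤n)) (suc m) (m≤n⇒m≤1+n M≤m))
  cancel : ∀ x y → (x ℤ.- y) ℤ.- (x ℤ.- (y ℤ.+ 1ℤ)) ≡ 1ℤ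
  cancel = solve-∀

theorem1 : ExcludedMiddle 0ℓ →
    (k : ℕ → ℕ) → IsK k →
    (t u : ℕ) (l : Vec ℤ (suc t)) (r : Vec ℤ (suc u)) →
    (b : ℕ → ℤ) → Associated k t u l r b →
    (h : ℕ) → Coprime h ∣ sumFin (suc u) (lookup r) ∣ →
    2 ≤ h → LowerDegreeAtLeast k (h + u ∸ 1) →
    (Cond1 h b ⊎ Cond2 h b ⊎ Cond3 k t l b h)
    × ¬ (Cond1 h b × Cond2 h b)
    × ¬ (Cond1 h b × Cond3 k t l b h)
theorem1 em k isK t u l r b assoc h@(suc _) R⊥h 2≤h low =
  trichotomy , (λ (cond1 , _ , ¬cond1) → ¬cond1 cond1) ,
  (λ (cond1 , cond3) → Cond1⇒¬Cond3 k t u l r b recurrence 2≤h cond1 cond3)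
  where
  open AssociatedSequence isK t u l r b assoc using (recurrence; ¬Eventually¬Coprime⇒Cond3)
  trichotomy : Cond1 h b ⊎ Cond2 h b ⊎ Cond3 k t l b h
  trichotomy with em {Cond1 h b} | em {Eventually (λ n → ¬ Coprime h ∣ b n ∣)}
  ... | yes cond1 | _           = inj₁ cond1
  ... | no ¬cond1 | yes ev      = inj₂ (inj₁ (ev , ¬cond1))
  ... | no ¬cond1 | no ¬ev      = inj₂ (inj₂ (¬Eventually¬Coprime⇒Cond3 em R⊥h low ¬ev))
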